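{- Let $\mathcal{N}\in\mathbb{N}$ be such that for all integers $m>\mathcal{N}$ and all positive integers $k\le 8m^3$, when $m$ robots independently choose one of $k$ destinations uniformly at random, the probability that some destination receives more than $\frac{m}{k}(1+k^{3/4})$ robots is at most $\frac{1}{2k}$ (such an $\mathcal{N}$ exists). Let $P$ be a point holding $m\ge1$ robots and let $u,x$ be positive integers. If each robot at $P$ independently moves to one of $k=\max(16x^4,u^3,8\mathcal{N}^3)$ destinations chosen uniformly at random, then with probability at least $1-\frac{1}{2u}$ the robots are divided into points each of multiplicity $1$ or each of multiplicity at most $m/x$ (i.e. the maximum number of robots at a single destination is $1$ or is at most $m/x$). -}

module Defs where

open import Data.Bool using (Bool; true; false; if_then_else_; _∧_; _∨_)
open import Data.Nat using (ℕ; zero; suc; _+_; _*_; _∸_; _^_; _⊔_; _≤ᵇ_; _<ᵇ_; _≡ᵇ_)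
open import Data.Fin using (Fin)
open import Data.Fin.Properties using (_≟_)
open import Data.Vec using (Vec; []; _∷_)
open import Data.List using (List; []; _∷_; concatMap; map; allFin; foldr)
open import Data.Nat.ListAction using (sum)
open import Relation.Nullary.Decidable using (⌊_⌋)

-- Sample space of m robots each choosing one of k destinations:
-- all assignments (robot i ↦ destination), each outcome equally likely
-- (probability 1/k^m each).
assignments : (m k : ℕ) → List (Vec (Fin k) m)
assignments zero    k = [] ∷ []
assignments (suc m) k = concatMap (λ d → map (d ∷_) (assignments m k)) (allFin k)

count : (m k : ℕ) → (Vec (Fin k) m → Bool) → ℕ
count m k p = sum (map (λ v → if p v then 1 else 0) (assignments m k))

load : ∀ {m k} → Vec (Fin k) m → Fin k → ℕ
load []      j = 0
load (d ∷ v) j = (if ⌊ d ≟ j ⌋ then 1 else 0) + load v j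

maxLoad : ∀ {m k} → Vec (Fin k) m → ℕ
maxLoad {m} {k} v = foldr _⊔_ 0 (map (load v) (allFin k))

-- exceeds m k c  ⇔  c > (m/k)(1 + k^{3/4})   (for k ≥ 1), i.e.
-- c·k − m > m·k^{3/4}, i.e. c·k > m and (c·k − m)^4 > m^4·k^3.
exceeds : (m k c : ℕ) → Bool
exceeds m k c = (m <ᵇ c * k) ∧ ((m ^ 4) * (k ^ 3) <ᵇ (c * k ∸ m) ^ 4)

overloaded : (m k : ℕ) → Vec (Fin k) m → Bool
overloaded m k v = exceeds m k (maxLoad v)

-- the defining property of 𝒩: for all m > 𝒩 and 1 ≤ k ≤ 8m^3,
-- Pr[overloaded] ≤ 1/(2k), i.e. #overloaded · 2k ≤ k^m.
GoodN : ℕ → Set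
GoodN N = ∀ (m k : ℕ) → N Data.Nat.< m → 1 Data.Nat.≤ k → k Data.Nat.≤ 8 * m ^ 3 →
          count m k (overloaded m k) * (2 * k) Data.Nat.≤ k ^ m

kOf : (N u x : ℕ) → ℕ
kOf N u x = (16 * x ^ 4) ⊔ (u ^ 3) ⊔ (8 * N ^ 3)

wellSplit : (m x k : ℕ) → Vec (Fin k) m → Bool
wellSplit m x k v = (maxLoad v ≡ᵇ 1) ∨ (maxLoad v * x ≤ᵇ m)

-- Call an outcome bad if it is not well split: its maximal load c satisfies
-- c ≥ 2 and c·x > m. If m > 𝒩 and k ≤ 8m³, every bad outcome is overloaded:
-- since k^{1/4} ≥ 2x, a load c ≤ (m/k)(1 + k^{3/4}) ≤ 2m·k^{-1/4} is at most
-- m/x. So Pr[bad] ≤ 1/(2k) ≤ 1/(2u). Otherwise k ≥ 8m³ (for m ≤ 𝒩 because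
-- k ≥ 8𝒩³), and a bad outcome sends two robots to one destination; by the
-- birthday bound this has probability at most m²/(2k), which is at most
-- 1/(2u) because u·m² ≤ max(u, m)³ ≤ k.
module Submission where

open import Defs
open import Data.Bool using (Bool; true; false; if_then_else_; _∨_; not; T)
open import Data.Bool.Properties using (T-∨; T-∧; T-not-≡)
open import Data.Empty using (⊥-elim)
open import Data.Fin using (Fin; zero; suc)
open import Data.Fin.Properties using (_≟_)
open import Data.List using (List; []; _∷_; _++_; map; concat; allFin; tabulate)
open import Data.List.Properties using (map-++; map-∘; map-tabulate)
open import Data.List.Membership.Propositional.Properties using (foldr-selective; ∈-map⁻)
open import Data.Nat hiding (_≟_)
open import Data.Nat.ListAction using (sum)
open import Data.Nat.ListAction.Properties using (sum-++)
open import Data.Nat.Properties hiding (_≟_)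
open import Algebra.Properties.Semiring.Sum +-*-semiring
  using (sum-syntax; sum-cong-≗; sum-replicate-zero; ∑-distrib-+; *-distribˡ-sum)
open import Data.Nat.Solver using (module +-*-Solver)
open import Data.Nat.Tactic.RingSolver using (solve-∀)
open import Data.Product using (∃-syntax; _×_; _,_; proj₁; proj₂)
open import Data.Sum using (inj₁; inj₂)
open import Data.Vec using (Vec; []; _∷_)
open import Function using (_∘_)
open import Function.Bundles using (module Equivalence)
open import Relation.Binary.PropositionalEquality
open import Relation.Nullary.Decidable using (does; yes; no)

open Equivalence using (to; from)

n≤n^[1+e] : ∀ {n} e → 1 ≤ n → n ≤ n ^ suc e
n≤n^[1+e] {n} e 1≤n = begin
  n          ≡⟨ *-identityʳ n ⟨
  n * 1      ≡⟨ cong (n *_) (^-zeroˡ e) ⟨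
  n * 1 ^ e  ≤⟨ *-monoʳ-≤ n (^-monoˡ-≤ e 1≤n) ⟩
  n * n ^ e  ∎
  where open ≤-Reasoning

2*x≤16*x^4 : ∀ {x} → 1 ≤ x → 2 * x ≤ 16 * x ^ 4
2*x≤16*x^4 1≤x = *-mono-≤ {2} {16} (s≤s (s≤s z≤n)) (n≤n^[1+e] 3 1≤x)

n*n*n≡n^3 : ∀ n → n * n * n ≡ n ^ 3
n*n*n≡n^3 = solve 1 (λ n → n :* n :* n := n :^ 3) refl
  where open +-*-Solver

a*b*b≤c : ∀ {a b c} → a ^ 3 ≤ c → b ^ 3 ≤ c → a * b * b ≤ c
a*b*b≤c {a} {b} a³≤c b³≤c with ≤-total a b
... | inj₁ a≤b = ≤-trans (*-monoˡ-≤ b (*-monoˡ-≤ b a≤b)) (≤-trans (≤-reflexive (n*n*n≡n^3 b)) b³≤c)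
... | inj₂ b≤a = ≤-trans (*-mono-≤ (*-monoʳ-≤ a b≤a) b≤a) (≤-trans (≤-reflexive (n*n*n≡n^3 a)) a³≤c)

^-cancelʳ-≤ : ∀ {a b} e .{{_ : NonZero e}} → a ^ e ≤ b ^ e → a ≤ b
^-cancelʳ-≤ e aᵉ≤bᵉ = ≮⇒≥ (λ b<a → <⇒≱ (^-monoˡ-< e b<a) aᵉ≤bᵉ)

tally : {A : Set} → (A → Bool) → List A → ℕ
tally p = sum ∘ map (λ a → if p a then 1 else 0)

module _ {A : Set} where

  tally-++ : ∀ (p : A → Bool) xs ys → tally p (xs ++ ys) ≡ tally p xs + tally p ys
  tally-++ p xs ys =
    trans (cong sum (map-++ indicator xs ys)) (sum-++ (map indicator xs) (map indicator ys))
    where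
    indicator : A → ℕ
    indicator a = if p a then 1 else 0

  tally-concat : ∀ (p : A → Bool) xss → tally p (concat xss) ≡ sum (map (tally p) xss)
  tally-concat p []         = refl
  tally-concat p (xs ∷ xss) = trans (tally-++ p xs (concat xss)) (cong (tally p xs +_) (tally-concat p xss))

  tally-map : ∀ {B : Set} (p : A → Bool) (f : B → A) xs → tally p (map f xs) ≡ tally (p ∘ f) xs
  tally-map p f xs = cong sum (sym (map-∘ xs))

  tally-complement : ∀ (p : A → Bool) xs → tally p xs + tally (not ∘ p) xs ≡ tally (λ _ → true) xs
  tally-complement p []       = refl
  tally-complement p (a ∷ xs) with p a
  ... | true  = cong suc (tally-complement p xs)
  ... | false = trans (+-suc _ _) (cong suc (tally-complement p xs))

  tally-mono : ∀ {p q : A → Bool} → (∀ a → T (p a) → T (q a)) → ∀ xs → tally p xs ≤ tally q xs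
  tally-mono p⇒q []       = z≤n
  tally-mono {p} {q} p⇒q (a ∷ xs) with p a in pa | q a in qa
  ... | false | _     = ≤-trans (tally-mono p⇒q xs) (m≤n+m _ _)
  ... | true  | true  = s≤s (tally-mono p⇒q xs)
  ... | true  | false = ⊥-elim (subst T qa (p⇒q a (subst T (sym pa) _)))

  tally-∨ : ∀ (p q : A → Bool) xs → tally (λ a → p a ∨ q a) xs ≤ tally p xs + tally q xs
  tally-∨ p q []       = z≤n
  tally-∨ p q (a ∷ xs) with p a | q a
  ... | true  | b     = s≤s (≤-trans (tally-∨ p q xs) (+-monoʳ-≤ (tally p xs) (m≤n+m _ (if b then 1 else 0))))
  ... | false | true  = subst (suc (tally (λ a → p a ∨ q a) xs) ≤_) (sym (+-suc (tally p xs) (tally q xs)))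
                              (s≤s (tally-∨ p q xs))
  ... | false | false = tally-∨ p q xs

∑-const : ∀ k c → ∑[ d < k ] c ≡ k * c
∑-const zero    c = refl
∑-const (suc k) c = cong (c +_) (∑-const k c)

∑-mono-≤ : ∀ {k} {f g : Fin k → ℕ} → (∀ d → f d ≤ g d) → ∑[ d < k ] f d ≤ ∑[ d < k ] g d
∑-mono-≤ {zero}  f≤g = z≤n
∑-mono-≤ {suc k} f≤g = +-mono-≤ (f≤g zero) (∑-mono-≤ (f≤g ∘ suc))

∑-indicator : ∀ {k} (j : Fin k) c → ∑[ d < k ] (if does (d ≟ j) then c else 0) ≡ c
∑-indicator {suc k} zero    c = trans (cong (c +_) (sum-replicate-zero k)) (+-identityʳ c)
∑-indicator {suc k} (suc j) c = ∑-indicator {k} j c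

sum-tabulate : ∀ {k} (f : Fin k → ℕ) → sum (tabulate f) ≡ ∑[ d < k ] f d
sum-tabulate {zero}  f = refl
sum-tabulate {suc k} f = cong (f zero +_) (sum-tabulate (f ∘ suc))

count-suc : ∀ m k (p : Vec (Fin k) (suc m) → Bool) →
            count (suc m) k p ≡ ∑[ d < k ] count m k (p ∘ (d ∷_))
count-suc m k p = begin
  tally p (concat (map branch (allFin k)))      ≡⟨ tally-concat p (map branch (allFin k)) ⟩
  sum (map (tally p) (map branch (allFin k)))   ≡⟨ cong sum (map-∘ (allFin k)) ⟨
  sum (map (tally p ∘ branch) (allFin k))       ≡⟨ cong sum (map-tabulate (λ d → d) (tally p ∘ branch)) ⟩
  sum (tabulate (tally p ∘ branch))             ≡⟨ sum-tabulate (tally p ∘ branch) ⟩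
  ∑[ d < k ] tally p (branch d)                 ≡⟨ sum-cong-≗ (λ d → tally-map p (d ∷_) (assignments m k)) ⟩
  ∑[ d < k ] count m k (p ∘ (d ∷_))             ∎
  where
  open ≡-Reasoning
  branch : Fin k → List (Vec (Fin k) (suc m))
  branch d = map (d ∷_) (assignments m k)

count-true : ∀ m k → count m k (λ _ → true) ≡ k ^ m
count-true zero    k = refl
count-true (suc m) k = begin
  count (suc m) k (λ _ → true)     ≡⟨ count-suc m k (λ _ → true) ⟩
  ∑[ d < k ] count m k (λ _ → true) ≡⟨ ∑-const k _ ⟩
  k * count m k (λ _ → true)        ≡⟨ cong (k *_) (count-true m k) ⟩
  k * k ^ m                         ∎
  where open ≡-Reasoning

count-complement : ∀ m k (p : Vec (Fin k) m → Bool) → count m k p + count m k (not ∘ p) ≡ k ^ m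
count-complement m k p = trans (tally-complement p (assignments m k)) (count-true m k)

count-≤-total : ∀ m k (p : Vec (Fin k) m → Bool) → count m k p ≤ k ^ m
count-≤-total m k p = subst (count m k p ≤_) (count-complement m k p) (m≤m+n _ _)

hit : ∀ {m k} → Fin k → Vec (Fin k) m → Bool
hit j v = 1 ≤ᵇ load v j

hasCollision : ∀ {m k} → Vec (Fin k) m → Bool
hasCollision []      = false
hasCollision (d ∷ v) = hasCollision v ∨ hit d v

hit-suc : ∀ m k (j : Fin k) → count (suc m) k (hit j) ≤ k ^ m + k * count m k (hit j)
hit-suc m k j = begin
  count (suc m) k (hit j)                     ≡⟨ count-suc m k (hit j) ⟩
  ∑[ d < k ] count m k (hit j ∘ (d ∷_))       ≤⟨ ∑-mono-≤ {k} first-robot ⟩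
  ∑[ d < k ] (at-j d + H)                     ≡⟨ ∑-distrib-+ at-j (λ _ → H) ⟩
  ∑[ d < k ] at-j d + ∑[ d < k ] H            ≡⟨ cong₂ _+_ (∑-indicator j (k ^ m)) (∑-const k H) ⟩
  k ^ m + k * H                               ∎
  where
  open ≤-Reasoning
  H : ℕ
  H = count m k (hit j)
  at-j : Fin k → ℕ
  at-j d = if does (d ≟ j) then k ^ m else 0
  first-robot : ∀ d → count m k (hit j ∘ (d ∷_)) ≤ at-j d + H
  first-robot d with d ≟ j
  ... | yes _ = ≤-trans (count-≤-total m k _) (m≤m+n _ _)
  ... | no  _ = ≤-refl

union-bound-hit : ∀ m k (j : Fin k) → k * count m k (hit j) ≤ m * k ^ m
union-bound-hit zero    k j = ≤-reflexive (*-zeroʳ k)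
union-bound-hit (suc m) k j = begin
  k * count (suc m) k (hit j)          ≤⟨ *-monoʳ-≤ k (hit-suc m k j) ⟩
  k * (k ^ m + k * count m k (hit j))  ≤⟨ *-monoʳ-≤ k (+-monoʳ-≤ (k ^ m) (union-bound-hit m k j)) ⟩
  k * (k ^ m + m * k ^ m)              ≡⟨ expand k m (k ^ m) ⟩
  suc m * k ^ suc m                    ∎
  where
  open ≤-Reasoning
  expand : ∀ k m K → k * (K + m * K) ≡ (1 + m) * (k * K)
  expand = solve-∀

hasCollision-suc : ∀ m k → count (suc m) k hasCollision ≤
                           k * count m k hasCollision + ∑[ d < k ] count m k (hit d)
hasCollision-suc m k = begin
  count (suc m) k hasCollision                          ≡⟨ count-suc m k hasCollision ⟩
  ∑[ d < k ] count m k (λ v → hasCollision v ∨ hit d v)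
    ≤⟨ ∑-mono-≤ {k} (λ d → tally-∨ hasCollision (hit d) (assignments m k)) ⟩
  ∑[ d < k ] (C + H d)                                  ≡⟨ ∑-distrib-+ (λ _ → C) H ⟩
  ∑[ d < k ] C + ∑[ d < k ] H d                         ≡⟨ cong (_+ ∑[ d < k ] H d) (∑-const k C) ⟩
  k * C + ∑[ d < k ] H d                                ∎
  where
  open ≤-Reasoning
  C : ℕ
  C = count m k hasCollision
  H : Fin k → ℕ
  H d = count m k (hit d)

birthday-bound : ∀ m k → k * (2 * count m k hasCollision) ≤ m * m * k ^ m
birthday-bound zero    k = ≤-reflexive (*-zeroʳ k)
birthday-bound (suc m) k = begin
  k * (2 * C (suc m))
    ≤⟨ *-monoʳ-≤ k (*-monoʳ-≤ 2 (hasCollision-suc m k)) ⟩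
  k * (2 * (k * C m + ∑[ d < k ] H d))
    ≡⟨ regroup k (C m) (∑[ d < k ] H d) ⟩
  k * (k * (2 * C m)) + 2 * (k * ∑[ d < k ] H d)
    ≡⟨ cong (λ s → k * (k * (2 * C m)) + 2 * s) (*-distribˡ-sum k H) ⟩
  k * (k * (2 * C m)) + 2 * ∑[ d < k ] (k * H d)
    ≤⟨ +-mono-≤ (*-monoʳ-≤ k (birthday-bound m k)) (*-monoʳ-≤ 2 (∑-mono-≤ {k} (union-bound-hit m k))) ⟩
  k * (m * m * k ^ m) + 2 * ∑[ d < k ] (m * k ^ m)
    ≡⟨ cong (λ s → k * (m * m * k ^ m) + 2 * s) (∑-const k _) ⟩
  k * (m * m * k ^ m) + 2 * (k * (m * k ^ m))
    ≤⟨ m≤m+n _ (k * k ^ m) ⟩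
  k * (m * m * k ^ m) + 2 * (k * (m * k ^ m)) + k * k ^ m
    ≡⟨ square k m (k ^ m) ⟩
  suc m * suc m * k ^ suc m
    ∎
  where
  open ≤-Reasoning
  C : ℕ → ℕ
  C n = count n k hasCollision
  H : Fin k → ℕ
  H d = count m k (hit d)
  regroup : ∀ k c s → k * (2 * (k * c + s)) ≡ k * (k * (2 * c)) + 2 * (k * s)
  regroup = solve-∀
  square : ∀ k m K → k * (m * m * K) + 2 * (k * (m * K)) + k * K ≡ (1 + m) * (1 + m) * (k * K)
  square = solve-∀

maxLoad-attained : ∀ {m k} (v : Vec (Fin k) m) → 0 < maxLoad v → ∃[ j ] maxLoad v ≡ load v j
maxLoad-attained {k = k} v 0<max with foldr-selective ⊔-sel 0 (map (load v) (allFin k))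
... | inj₁ max≡0 = ⊥-elim (<⇒≢ 0<max (sym max≡0))
... | inj₂ max∈  with ∈-map⁻ (load v) max∈
...   | j , _ , max≡load = j , max≡load

load≥2⇒hasCollision : ∀ {m k} (v : Vec (Fin k) m) j → 2 ≤ load v j → T (hasCollision v)
load≥2⇒hasCollision []      j ()
load≥2⇒hasCollision (d ∷ v) j 2≤load with d ≟ j
... | yes refl = from T-∨ (inj₂ (≤⇒≤ᵇ (s≤s⁻¹ 2≤load)))
... | no  _    = from T-∨ (inj₁ (load≥2⇒hasCollision v j 2≤load))

¬wellSplit⇒maxLoad : ∀ {m x k} (v : Vec (Fin k) m) → T (not (wellSplit m x k v)) →
                     2 ≤ maxLoad v × m < maxLoad v * x
¬wellSplit⇒maxLoad {m} {x} v = bounds (maxLoad v)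
  where
  bounds : ∀ c → T (not ((c ≡ᵇ 1) ∨ (c * x ≤ᵇ m))) → 2 ≤ c × m < c * x
  bounds 0             ()
  bounds 1             ()
  bounds (suc (suc c)) ¬split =
    s≤s (s≤s z≤n) , ≰⇒> (λ cx≤m → subst T (to T-not-≡ ¬split) (≤⇒≤ᵇ cx≤m))

¬wellSplit⇒hasCollision : ∀ {m x k} (v : Vec (Fin k) m) → T (not (wellSplit m x k v)) → T (hasCollision v)
¬wellSplit⇒hasCollision v ¬split =
  let j , max≡load = maxLoad-attained v (≤-trans (s≤s z≤n) 2≤max)
  in load≥2⇒hasCollision v j (subst (2 ≤_) max≡load 2≤max)
  where
  2≤max : 2 ≤ maxLoad v
  2≤max = proj₁ (¬wellSplit⇒maxLoad v ¬split)

-- With d = c·k ∸ m, the hypothesis says d ≤ m·k^{3/4}, and 2x ≤ k^{1/4}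
-- turns this into 2x·d ≤ m·k; hence 2x·c·k ≤ 2x·m + m·k ≤ 2·m·k.
small-excess⇒*≤ : ∀ {m k x} c → 1 ≤ x → 16 * x ^ 4 ≤ k → (c * k ∸ m) ^ 4 ≤ m ^ 4 * k ^ 3 → c * x ≤ m
small-excess⇒*≤ {m} {k} {x} c 1≤x 16x⁴≤k d⁴≤ = *-cancelʳ-≤ (c * x) m (2 * k) {{2k≢0}} (begin
  c * x * (2 * k)        ≡⟨ regroup c x k ⟩
  2 * x * (c * k)        ≤⟨ *-monoʳ-≤ (2 * x) (m≤n+m∸n (c * k) m) ⟩
  2 * x * (m + d)        ≡⟨ *-distribˡ-+ (2 * x) m d ⟩
  2 * x * m + 2 * x * d  ≤⟨ +-mono-≤ (*-monoˡ-≤ m 2x≤k) 2xd≤mk ⟩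
  k * m + m * k          ≡⟨ double m k ⟩
  m * (2 * k)            ∎)
  where
  open ≤-Reasoning
  open +-*-Solver using (solve; _:*_; _:^_; _:=_; con)
  d : ℕ
  d = c * k ∸ m
  2x≤k : 2 * x ≤ k
  2x≤k = ≤-trans (2*x≤16*x^4 1≤x) 16x⁴≤k
  2k≢0 : NonZero (2 * k)
  2k≢0 = >-nonZero (≤-trans (≤-trans 1≤x (m≤n*m x 2)) (≤-trans 2x≤k (m≤n*m k 2)))
  regroup : ∀ c x k → c * x * (2 * k) ≡ 2 * x * (c * k)
  regroup = solve-∀
  double : ∀ m k → k * m + m * k ≡ m * (2 * k)
  double = solve-∀
  2xd≤mk : 2 * x * d ≤ m * k
  2xd≤mk = ^-cancelʳ-≤ 4 (begin
    (2 * x * d) ^ 4      ≡⟨ solve 2 (λ x d → (con 2 :* x :* d) :^ 4 := con 16 :* x :^ 4 :* d :^ 4) refl x d ⟩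
    16 * x ^ 4 * d ^ 4   ≤⟨ *-mono-≤ 16x⁴≤k d⁴≤ ⟩
    k * (m ^ 4 * k ^ 3)  ≡⟨ solve 2 (λ k m → k :* (m :^ 4 :* k :^ 3) := (m :* k) :^ 4) refl k m ⟩
    (m * k) ^ 4          ∎)

*>⇒exceeds : ∀ {m k x} c → 1 ≤ x → 16 * x ^ 4 ≤ k → m < c * x → T (exceeds m k c)
*>⇒exceeds {m} {k} {x} c 1≤x 16x⁴≤k m<cx = from T-∧ (<⇒<ᵇ m<ck , <⇒<ᵇ large-excess)
  where
  x≤k : x ≤ k
  x≤k = ≤-trans (m≤n*m x 2) (≤-trans (2*x≤16*x^4 1≤x) 16x⁴≤k)
  m<ck : m < c * k
  m<ck = ≤-trans m<cx (*-monoʳ-≤ c x≤k)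
  large-excess : m ^ 4 * k ^ 3 < (c * k ∸ m) ^ 4
  large-excess = ≰⇒> (λ d⁴≤ → <⇒≱ m<cx (small-excess⇒*≤ c 1≤x 16x⁴≤k d⁴≤))

¬wellSplit⇒overloaded : ∀ {m x k} → 1 ≤ x → 16 * x ^ 4 ≤ k → (v : Vec (Fin k) m) →
                        T (not (wellSplit m x k v)) → T (overloaded m k v)
¬wellSplit⇒overloaded 1≤x 16x⁴≤k v ¬split =
  *>⇒exceeds (maxLoad v) 1≤x 16x⁴≤k (proj₂ (¬wellSplit⇒maxLoad v ¬split))

¬wellSplit-bound-moderate : ∀ {N m k u x} → GoodN N → N < m → k ≤ 8 * m ^ 3 → 1 ≤ u → 1 ≤ x →
                            16 * x ^ 4 ≤ k → u ^ 3 ≤ k → 2 * u * count m k (not ∘ wellSplit m x k) ≤ k ^ m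
¬wellSplit-bound-moderate {N} {m} {k} {u} {x} good N<m k≤8m³ 1≤u 1≤x 16x⁴≤k u³≤k = begin
  2 * u * count m k (not ∘ wellSplit m x k)
    ≤⟨ *-monoʳ-≤ (2 * u) (tally-mono (¬wellSplit⇒overloaded 1≤x 16x⁴≤k) (assignments m k)) ⟩
  2 * u * O  ≤⟨ *-monoˡ-≤ O (*-monoʳ-≤ 2 u≤k) ⟩
  2 * k * O  ≡⟨ *-comm (2 * k) O ⟩
  O * (2 * k) ≤⟨ good m k N<m (≤-trans 1≤u u≤k) k≤8m³ ⟩
  k ^ m      ∎
  where
  open ≤-Reasoning
  O : ℕ
  O = count m k (overloaded m k)
  u≤k : u ≤ k
  u≤k = ≤-trans (n≤n^[1+e] 2 1≤u) u³≤k

¬wellSplit-bound-large : ∀ {m k u x} → 1 ≤ u → u ^ 3 ≤ k → 8 * m ^ 3 ≤ k →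
                         2 * u * count m k (not ∘ wellSplit m x k) ≤ k ^ m
¬wellSplit-bound-large {m} {k} {u} {x} 1≤u u³≤k 8m³≤k = *-cancelˡ-≤ k {{k≢0}} (begin
  k * (2 * u * count m k (not ∘ wellSplit m x k))
    ≤⟨ *-monoʳ-≤ k (*-monoʳ-≤ (2 * u) (tally-mono ¬wellSplit⇒hasCollision (assignments m k))) ⟩
  k * (2 * u * C)        ≡⟨ regroup k u C ⟩
  u * (k * (2 * C))      ≤⟨ *-monoʳ-≤ u (birthday-bound m k) ⟩
  u * (m * m * k ^ m)    ≡⟨ regroup′ u m (k ^ m) ⟩
  u * m * m * k ^ m      ≤⟨ *-monoˡ-≤ (k ^ m) (a*b*b≤c {u} {m} u³≤k (≤-trans (m≤n*m (m ^ 3) 8) 8m³≤k)) ⟩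
  k * k ^ m              ∎)
  where
  open ≤-Reasoning
  C : ℕ
  C = count m k hasCollision
  k≢0 : NonZero k
  k≢0 = >-nonZero (≤-trans 1≤u (≤-trans (n≤n^[1+e] 2 1≤u) u³≤k))
  regroup : ∀ k u c → k * (2 * u * c) ≡ u * (k * (2 * c))
  regroup = solve-∀
  regroup′ : ∀ u m K → u * (m * m * K) ≡ u * m * m * K
  regroup′ = solve-∀

¬wellSplit-bound : ∀ {N m k u x} → GoodN N → 1 ≤ u → 1 ≤ x →
                   16 * x ^ 4 ≤ k → u ^ 3 ≤ k → 8 * N ^ 3 ≤ k →
                   2 * u * count m k (not ∘ wellSplit m x k) ≤ k ^ m
¬wellSplit-bound {N} {m} {k} {u} {x} good 1≤u 1≤x 16x⁴≤k u³≤k 8N³≤k with N <? m | k ≤? 8 * m ^ 3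
... | yes N<m | yes k≤8m³ = ¬wellSplit-bound-moderate {x = x} good N<m k≤8m³ 1≤u 1≤x 16x⁴≤k u³≤k
... | yes _   | no  k≰8m³ = ¬wellSplit-bound-large {m} {x = x} 1≤u u³≤k (<⇒≤ (≰⇒> k≰8m³))
... | no  N≮m | _         = ¬wellSplit-bound-large {m} {x = x} 1≤u u³≤k
                              (≤-trans (*-monoʳ-≤ 8 (^-monoˡ-≤ 3 (≮⇒≥ N≮m))) 8N³≤k)

lemma7 : (N : ℕ) → GoodN N → (m u x : ℕ) → 1 ≤ m → 1 ≤ u → 1 ≤ x →
         (2 * u) * (kOf N u x) ^ m ≤ (2 * u) * count m (kOf N u x) (wellSplit m x (kOf N u x)) + (kOf N u x) ^ m
lemma7 N good m u x _ 1≤u 1≤x = begin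
  2 * u * k ^ m          ≡⟨ cong (2 * u *_) (count-complement m k (wellSplit m x k)) ⟨
  2 * u * (G + B)        ≡⟨ *-distribˡ-+ (2 * u) G B ⟩
  2 * u * G + 2 * u * B
    ≤⟨ +-monoʳ-≤ (2 * u * G) (¬wellSplit-bound {m = m} {x = x} good 1≤u 1≤x 16x⁴≤k u³≤k 8N³≤k) ⟩
  2 * u * G + k ^ m      ∎
  where
  open ≤-Reasoning
  k G B : ℕ
  k = kOf N u x
  G = count m k (wellSplit m x k)
  B = count m k (not ∘ wellSplit m x k)
  16x⁴≤k : 16 * x ^ 4 ≤ k
  16x⁴≤k = ≤-trans (m≤m⊔n _ _) (m≤m⊔n _ _)
  u³≤k : u ^ 3 ≤ k
  u³≤k = ≤-trans (m≤n⊔m (16 * x ^ 4) _) (m≤m⊔n _ _)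
  8N³≤k : 8 * N ^ 3 ≤ k
  8N³≤k = m≤n⊔m _ _
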